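{- Let $G$ be an $r$-regular graph with $n$ vertices, let $k\ge 0$ be an integer, let $S(G)$ be the $3k$-subdivision of $G$, and let $P$ be a perfect edge dominating set of $S(G)$. Then (1) for every $e\in E(G)$, $|S(N'[e])\cap P|\ge 2rk-k+1$; (2) $|P|\ge \frac{nr}{2(2r-1)}\cdot(2rk-k+1)$.
   Context: Graphs are finite, simple and undirected. An edge dominates itself and every edge sharing an endpoint with it. A set $P\subseteq E(H)$ is a perfect edge dominating set of $H$ if every edge of $E(H)\setminus P$ is dominated by exactly one edge of $P$. For an edge $e$ of $G$, $N'[e]$ is the set consisting of $e$ and all edges of $G$ sharing an endpoint with $e$. For an integer $m\ge0$ and an edge $e=vw$, the $m$-subdivision of $e$ replaces $e$ by a path $S(e)$ with edges $e_0,\dots,e_m$ whose $m$ internal vertices are new vertices of degree 2, with $e_0$ incident to $v$ and $e_m$ incident to $w$; $S(G)$ is obtained by subdividing every edge of $G$ in this way (here $m=3k$), and for $E'\subseteq E(G)$, $S(E')$ denotes the union of the edge sets of the paths $S(e)$, $e\in E'$. -}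

module Defs where

open import Data.Nat using (ℕ; zero; suc; _+_)
open import Data.Bool using (Bool; true; false; T; _∧_; _∨_; if_then_else_)
open import Data.Fin using (Fin; zero; suc; _<_)
open import Data.Fin.Properties using (_≟_; _<?_)
open import Data.List using (List; map; allFin)
open import Data.Nat.ListAction using (sum)
open import Data.Maybe using (Maybe; just; nothing)
import Data.Maybe as Maybe
open import Data.Product using (Σ; _×_; _,_)
open import Data.Sum using (_⊎_; inj₁; inj₂)
open import Relation.Nullary using (yes; no)
open import Relation.Nullary.Decidable using (⌊_⌋; T?)
open import Relation.Binary.PropositionalEquality using (_≡_)

record Graph (n : ℕ) : Set where
  field
    adj    : Fin n → Fin n → Bool
    sym    : ∀ u v → adj u v ≡ adj v u
    irrefl : ∀ v → adj v v ≡ false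
open Graph public

count : ∀ {A : Set} → (A → Bool) → List A → ℕ
count p xs = sum (map (λ x → if p x then 1 else 0) xs)

degree : ∀ {n} → Graph n → Fin n → ℕ
degree {n} G v = count (adj G v) (allFin n)

Regular : ∀ {n} → Graph n → ℕ → Set
Regular G r = ∀ v → degree G v ≡ r

Edge : ∀ {n} → Graph n → Set
Edge {n} G = Σ (Fin n) λ u → Σ (Fin n) λ v → (u < v) × T (adj G u v)

sumEdgeTerm : ∀ {n} (G : Graph n) → (Edge G → ℕ) → Fin n → Fin n → ℕ
sumEdgeTerm G f u v with u <? v | T? (adj G u v)
... | yes p | yes q = f (u , v , p , q)
... | _     | _     = 0

sumE : ∀ {n} (G : Graph n) → (Edge G → ℕ) → ℕ
sumE {n} G f = sum (map (λ u → sum (map (λ v → sumEdgeTerm G f u v) (allFin n))) (allFin n))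

eqF : ∀ {n} → Fin n → Fin n → Bool
eqF a b = ⌊ a ≟ b ⌋

inClosedNbhd : ∀ {n} {G : Graph n} → Edge G → Edge G → Bool
inClosedNbhd (u , v , _) (u' , v' , _) =
  (eqF u u' ∧ eqF v v') ∨ (eqF u u' ∨ eqF u v' ∨ eqF v u' ∨ eqF v v')

-- The m-subdivision S(G)
-- Edge e = uv (u < v) becomes the path u = w_0, w_1, ..., w_m, w_{m+1} = v,
-- e_i = w_i w_{i+1}  (i = 0..m), e_0 incident to u, e_m incident to v.
-- Internal vertex w_{j+1} of S(e) is represented as inj₂ (u , v , j), j : Fin m.

SVertex : ℕ → ℕ → Set
SVertex n m = Fin n ⊎ (Fin n × Fin n × Fin m)

SEdge : ∀ {n} → Graph n → ℕ → Set
SEdge G m = Edge G × Fin (suc m)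

lowerM : (m : ℕ) → Fin (suc m) → Maybe (Fin m)
lowerM zero    zero    = nothing
lowerM (suc m) zero    = just zero
lowerM (suc m) (suc i) = Maybe.map suc (lowerM m i)

leftEnd : ∀ {n} {G : Graph n} {m} → SEdge G m → SVertex n m
leftEnd ((u , v , _) , zero)  = inj₁ u
leftEnd ((u , v , _) , suc j) = inj₂ (u , v , j)

rightEnd : ∀ {n} {G : Graph n} {m} → SEdge G m → SVertex n m
rightEnd {m = m} ((u , v , _) , i) with lowerM m i
... | nothing = inj₁ v
... | just j  = inj₂ (u , v , j)

eqV : ∀ {n m} → SVertex n m → SVertex n m → Bool
eqV (inj₁ a) (inj₁ b) = eqF a b
eqV (inj₂ (a , b , c)) (inj₂ (a' , b' , c')) = eqF a a' ∧ eqF b b' ∧ eqF c c'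
eqV _ _ = false

sameSEdge : ∀ {n} {G : Graph n} {m} → SEdge G m → SEdge G m → Bool
sameSEdge ((u , v , _) , i) ((u' , v' , _) , i') = eqF u u' ∧ eqF v v' ∧ eqF i i'

shareEnd : ∀ {n} {G : Graph n} {m} → SEdge G m → SEdge G m → Bool
shareEnd {G = G} {m} f g =
    eqV (leftEnd {G = G} {m} f) (leftEnd {G = G} {m} g) ∨ eqV (leftEnd {G = G} {m} f) (rightEnd {G = G} {m} g)
  ∨ eqV (rightEnd {G = G} {m} f) (leftEnd {G = G} {m} g) ∨ eqV (rightEnd {G = G} {m} f) (rightEnd {G = G} {m} g)

dominates : ∀ {n} {G : Graph n} {m} → SEdge G m → SEdge G m → Bool
dominates {G = G} {m} g f = sameSEdge {G = G} {m} g f ∨ shareEnd {G = G} {m} g f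

sumSE : ∀ {n} (G : Graph n) (m : ℕ) → (SEdge G m → ℕ) → ℕ
sumSE G m f = sumE G (λ e → sum (map (λ i → f (e , i)) (allFin (suc m))))

countSE : ∀ {n} (G : Graph n) (m : ℕ) → (SEdge G m → Bool) → ℕ
countSE G m p = sumSE G m (λ f → if p f then 1 else 0)

PerfectEdgeDominating : ∀ {n} (G : Graph n) (m : ℕ) → (SEdge G m → Bool) → Set
PerfectEdgeDominating G m P =
  ∀ f → P f ≡ false → countSE G m (λ g → P g ∧ dominates {G = G} {m} g f) ≡ 1

countSNbhd : ∀ {n} (G : Graph n) (m : ℕ) → (SEdge G m → Bool) → Edge G → ℕ
countSNbhd G m P e = countSE G m (λ g → inClosedNbhd {G = G} (Data.Product.proj₁ g) e ∧ P g)

-- Write e₀, …, e₃ₖ for the edges of the path S(e) replacing an edge e of G.  An internal edge eₜ can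
-- only be dominated by itself or by eₜ₋₁, eₜ₊₁, so any three consecutive edges of S(e) meet P and
-- |S(e) ∩ P| ≥ k.  How the end edges e₀ and e₃ₖ are dominated yields an edge e′ ∈ N′[e] with
-- |S(e′) ∩ P| ≥ k + 1: either P contains an end edge of some S(e′) with e′ touching e, or e₁ and
-- e₃ₖ₋₁ lie in P and enclose k − 1 further disjoint triples.  Since |N′[e]| = 2r − 1, this gives (1);
-- summing (1) over the nr/2 edges counts each |S(e′) ∩ P| exactly |N′[e′]| = 2r − 1 times, giving (2).

module Submission where

open import Defs hiding (sym)
open import Data.Bool using (Bool; true; false; T; _∧_; _∨_; if_then_else_)
open import Data.Bool.Properties using (T-irrelevant; ∨-comm; ∨-zeroʳ; ∨-commutativeMonoid)
open import Data.Empty using (⊥-elim)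
open import Data.Fin using (Fin; zero; suc; toℕ; fromℕ; fromℕ<)
import Data.Fin.Properties as Fin
open import Data.Maybe using (just; nothing)
open import Data.List using (List; []; _∷_; _++_; map; concatMap; allFin)
open import Data.List.Properties using (map-tabulate)
open import Data.List.Membership.Propositional using (_∈_; lose)
open import Data.List.Membership.Propositional.Properties using (∈-allFin; ∈-concatMap⁺)
open import Data.List.Relation.Unary.Any using (here; there)
open import Data.Nat using (ℕ; zero; suc; _+_; _*_; _∸_; _≤_; _<_; z≤n; s≤s; _≤?_)
open import Data.Nat.ListAction using (sum)
open import Data.Nat.Properties
open import Data.Product using (∃-syntax; _×_; _,_; proj₁; proj₂)
open import Data.Sum using (_⊎_; inj₁; inj₂)
open import Function using (_∘_)
open import Relation.Nullary using (yes; no; ¬_)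
open import Relation.Nullary.Decidable using (⌊_⌋; T?)
open import Relation.Binary.PropositionalEquality
open import Algebra.Bundles using (CommutativeMonoid)
open import Algebra.Properties.CommutativeSemigroup +-commutativeSemigroup
  using () renaming (interchange to +-interchange)
open import Algebra.Properties.CommutativeSemigroup
  (CommutativeMonoid.commutativeSemigroup ∨-commutativeMonoid)
  using () renaming (interchange to ∨-interchange)

𝟙 : Bool → ℕ
𝟙 b = if b then 1 else 0

T⇒≡true : ∀ {b} → T b → b ≡ true
T⇒≡true {true} _ = refl

¬T⇒≡false : ∀ {b} → ¬ T b → b ≡ false
¬T⇒≡false {true}  ¬b = ⊥-elim (¬b _)
¬T⇒≡false {false} _  = refl

𝟙-true : ∀ {b} → b ≡ true → 0 < 𝟙 b
𝟙-true refl = s≤s z≤n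

𝟙-positive : ∀ {b} → 0 < 𝟙 b → b ≡ true
𝟙-positive {true} _ = refl

∨-introˡ : ∀ {a b} → a ≡ true → a ∨ b ≡ true
∨-introˡ refl = refl

∨-introʳ : ∀ a {b} → b ≡ true → a ∨ b ≡ true
∨-introʳ a refl = ∨-zeroʳ a

∨-≡true : ∀ a {b} → a ∨ b ≡ true → a ≡ true ⊎ b ≡ true
∨-≡true true  _ = inj₁ refl
∨-≡true false h = inj₂ h

∧-≡true : ∀ a {b} → a ∧ b ≡ true → a ≡ true × b ≡ true
∧-≡true true h = refl , h

𝟙-inclusion-exclusion : ∀ c x y →
                        𝟙 c * 𝟙 (x ∨ y) + 𝟙 x * (𝟙 y * 𝟙 c) ≡ 𝟙 x * 𝟙 c + 𝟙 y * 𝟙 c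
𝟙-inclusion-exclusion false false false = refl
𝟙-inclusion-exclusion false false true  = refl
𝟙-inclusion-exclusion false true  false = refl
𝟙-inclusion-exclusion false true  true  = refl
𝟙-inclusion-exclusion true  false false = refl
𝟙-inclusion-exclusion true  false true  = refl
𝟙-inclusion-exclusion true  true  false = refl
𝟙-inclusion-exclusion true  true  true  = refl

eqF⇒≡ : ∀ {n} {a b : Fin n} → eqF a b ≡ true → a ≡ b
eqF⇒≡ {a = a} {b} eq with a Fin.≟ b
... | yes a≡b = a≡b

eqF-refl : ∀ {n} (a : Fin n) → eqF a a ≡ true
eqF-refl a with a Fin.≟ a
... | yes _   = refl
... | no  a≢a = ⊥-elim (a≢a refl)

eqF-sym : ∀ {n} (a b : Fin n) → eqF a b ≡ eqF b a
eqF-sym a b with a Fin.≟ b | b Fin.≟ a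
... | yes _   | yes _   = refl
... | no  _   | no  _   = refl
... | yes a≡b | no  b≢a = ⊥-elim (b≢a (sym a≡b))
... | no  a≢b | yes b≡a = ⊥-elim (a≢b (sym b≡a))

eqF-suc : ∀ {n} (a b : Fin n) → eqF (suc a) (suc b) ≡ eqF a b
eqF-suc a b with a Fin.≟ b
... | yes _ = refl
... | no  _ = refl

-- Finite sums

∑ : {A : Set} → List A → (A → ℕ) → ℕ
∑ xs f = sum (map f xs)

module _ {A : Set} where

  ∑-cong : ∀ xs {f g : A → ℕ} → (∀ x → f x ≡ g x) → ∑ xs f ≡ ∑ xs g
  ∑-cong []       f≗g = refl
  ∑-cong (x ∷ xs) f≗g = cong₂ _+_ (f≗g x) (∑-cong xs f≗g)

  ∑-mono-≤ : ∀ xs {f g : A → ℕ} → (∀ x → f x ≤ g x) → ∑ xs f ≤ ∑ xs g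
  ∑-mono-≤ []       f≤g = z≤n
  ∑-mono-≤ (x ∷ xs) f≤g = +-mono-≤ (f≤g x) (∑-mono-≤ xs f≤g)

  ∑-mono-< : ∀ {xs} {f g : A → ℕ} {y} → (∀ x → f x ≤ g x) → y ∈ xs → f y < g y →
             ∑ xs f < ∑ xs g
  ∑-mono-< {_ ∷ xs} f≤g (here refl) fy<gy = +-mono-<-≤ fy<gy (∑-mono-≤ xs f≤g)
  ∑-mono-< {x ∷ _}  f≤g (there y∈xs) fy<gy = +-mono-≤-< (f≤g x) (∑-mono-< f≤g y∈xs fy<gy)

  ∑-zero : ∀ xs → ∑ xs (λ (_ : A) → 0) ≡ 0
  ∑-zero []       = refl
  ∑-zero (x ∷ xs) = ∑-zero xs

  ∑-+ : ∀ xs (f g : A → ℕ) → ∑ xs (λ x → f x + g x) ≡ ∑ xs f + ∑ xs g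
  ∑-+ []       f g = refl
  ∑-+ (x ∷ xs) f g = trans (cong (f x + g x +_) (∑-+ xs f g)) (+-interchange (f x) (g x) _ _)

  ∑-*ˡ : ∀ xs c (f : A → ℕ) → ∑ xs (λ x → c * f x) ≡ c * ∑ xs f
  ∑-*ˡ []       c f = sym (*-zeroʳ c)
  ∑-*ˡ (x ∷ xs) c f = trans (cong (c * f x +_) (∑-*ˡ xs c f)) (sym (*-distribˡ-+ c (f x) _))

  ∑-*ʳ : ∀ xs c (f : A → ℕ) → ∑ xs (λ x → f x * c) ≡ ∑ xs f * c
  ∑-*ʳ xs c f = trans (∑-cong xs (λ x → *-comm (f x) c)) (trans (∑-*ˡ xs c f) (*-comm c _))

  ∑-++ : ∀ xs ys (f : A → ℕ) → ∑ (xs ++ ys) f ≡ ∑ xs f + ∑ ys f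
  ∑-++ []       ys f = refl
  ∑-++ (x ∷ xs) ys f = trans (cong (f x +_) (∑-++ xs ys f)) (sym (+-assoc (f x) _ _))

  ∑-positive : ∀ xs (f : A → ℕ) → 0 < ∑ xs f → ∃[ x ] 0 < f x
  ∑-positive (x ∷ xs) f pos with f x in fx≡
  ... | suc _ = x , subst (0 <_) (sym fx≡) (s≤s z≤n)
  ... | zero  = ∑-positive xs f pos

∑-concatMap : ∀ {A B : Set} (h : A → List B) xs (f : B → ℕ) →
              ∑ (concatMap h xs) f ≡ ∑ xs (λ x → ∑ (h x) f)
∑-concatMap h []       f = refl
∑-concatMap h (x ∷ xs) f = trans (∑-++ (h x) _ f) (cong (∑ (h x) f +_) (∑-concatMap h xs f))

∑-comm : ∀ {A B : Set} xs ys (f : A → B → ℕ) →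
         ∑ xs (λ x → ∑ ys (f x)) ≡ ∑ ys (λ y → ∑ xs (λ x → f x y))
∑-comm []       ys f = sym (∑-zero ys)
∑-comm (x ∷ xs) ys f =
  trans (cong (∑ ys (f x) +_) (∑-comm xs ys f)) (sym (∑-+ ys (f x) _))

∑-𝟙-∧ : ∀ {A : Set} xs b (c : A → Bool) →
        ∑ xs (λ x → 𝟙 (b ∧ c x)) ≡ 𝟙 b * ∑ xs (𝟙 ∘ c)
∑-𝟙-∧ xs true  c = sym (+-identityʳ _)
∑-𝟙-∧ xs false c = ∑-zero xs

∑-allFin-suc : ∀ n (f : Fin (suc n) → ℕ) → ∑ (allFin (suc n)) f ≡ f zero + ∑ (allFin n) (f ∘ suc)
∑-allFin-suc n f = cong (λ fs → f zero + sum fs)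
  (trans (map-tabulate suc f) (sym (map-tabulate (λ i → i) (f ∘ suc))))

∑-allFin-const : ∀ n c → ∑ (allFin n) (λ _ → c) ≡ n * c
∑-allFin-const zero    c = refl
∑-allFin-const (suc n) c = trans (∑-allFin-suc n (λ _ → c)) (cong (c +_) (∑-allFin-const n c))

∑-allFin-eqF : ∀ n (u : Fin n) (g : Fin n → ℕ) → ∑ (allFin n) (λ x → 𝟙 (eqF x u) * g x) ≡ g u
∑-allFin-eqF (suc n) zero g =
  trans (∑-allFin-suc n _)
        (trans (cong₂ _+_ (+-identityʳ (g zero)) (∑-zero (allFin n))) (+-identityʳ (g zero)))
∑-allFin-eqF (suc n) (suc u) g = begin
  ∑ (allFin (suc n)) (λ x → 𝟙 (eqF x (suc u)) * g x)
    ≡⟨ ∑-allFin-suc n (λ x → 𝟙 (eqF x (suc u)) * g x) ⟩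
  ∑ (allFin n) (λ x → 𝟙 (eqF (suc x) (suc u)) * g (suc x))
    ≡⟨ ∑-cong (allFin n) (λ x → cong (λ b → 𝟙 b * g (suc x)) (eqF-suc x u)) ⟩
  ∑ (allFin n) (λ x → 𝟙 (eqF x u) * g (suc x))
    ≡⟨ ∑-allFin-eqF n u (g ∘ suc) ⟩
  g (suc u)                                                ∎
  where open ≡-Reasoning

∑-allFin-pair : ∀ n {u v : Fin n} → u ≢ v → (g : Fin n → ℕ) →
                ∑ (allFin n) (λ x → 𝟙 (eqF x u ∨ eqF x v) * g x) ≡ g u + g v
∑-allFin-pair n {u} {v} u≢v g = begin
  ∑ (allFin n) (λ x → 𝟙 (eqF x u ∨ eqF x v) * g x)            ≡⟨ ∑-cong (allFin n) split ⟩
  ∑ (allFin n) (λ x → 𝟙 (eqF x u) * g x + 𝟙 (eqF x v) * g x)  ≡⟨ ∑-+ (allFin n) _ _ ⟩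
  ∑ (allFin n) (λ x → 𝟙 (eqF x u) * g x) + ∑ (allFin n) (λ x → 𝟙 (eqF x v) * g x)
    ≡⟨ cong₂ _+_ (∑-allFin-eqF n u g) (∑-allFin-eqF n v g) ⟩
  g u + g v                                                    ∎
  where
  open ≡-Reasoning
  split : ∀ x → 𝟙 (eqF x u ∨ eqF x v) * g x ≡ 𝟙 (eqF x u) * g x + 𝟙 (eqF x v) * g x
  split x with eqF x u in x≡u | eqF x v in x≡v
  ... | true  | true  = ⊥-elim (u≢v (trans (sym (eqF⇒≡ x≡u)) (eqF⇒≡ x≡v)))
  ... | true  | false = sym (+-identityʳ _)
  ... | false | _     = refl

∑∑ : ∀ n → (Fin n → Fin n → ℕ) → ℕ
∑∑ n H = ∑ (allFin n) λ a → ∑ (allFin n) (H a)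

∑∑-transpose : ∀ n (H : Fin n → Fin n → ℕ) → ∑∑ n H ≡ ∑∑ n (λ a b → H b a)
∑∑-transpose n H = ∑-comm (allFin n) (allFin n) H

∑∑-cong : ∀ n {H K : Fin n → Fin n → ℕ} → (∀ a b → H a b ≡ K a b) → ∑∑ n H ≡ ∑∑ n K
∑∑-cong n H≗K = ∑-cong (allFin n) (λ a → ∑-cong (allFin n) (H≗K a))

∑∑-+ : ∀ n (H K : Fin n → Fin n → ℕ) → ∑∑ n (λ a b → H a b + K a b) ≡ ∑∑ n H + ∑∑ n K
∑∑-+ n H K = trans (∑-cong (allFin n) (λ a → ∑-+ (allFin n) (H a) (K a))) (∑-+ (allFin n) _ _)

∑∑-symmetric : ∀ n (H : Fin n → Fin n → ℕ) → (∀ a → H a a ≡ 0) → (∀ a b → H a b ≡ H b a) →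
               ∑∑ n H ≡ 2 * ∑∑ n (λ a b → 𝟙 ⌊ a Fin.<? b ⌋ * H a b)
∑∑-symmetric n H diag sym-H = begin
  ∑∑ n H                                  ≡⟨ ∑∑-cong n by-order ⟩
  ∑∑ n (λ a b → below a b + below b a)    ≡⟨ ∑∑-+ n below (λ a b → below b a) ⟩
  ∑∑ n below + ∑∑ n (λ a b → below b a)   ≡⟨ cong (∑∑ n below +_) (sym (∑∑-transpose n below)) ⟩
  ∑∑ n below + ∑∑ n below                 ≡⟨ cong (∑∑ n below +_) (sym (+-identityʳ _)) ⟩
  2 * ∑∑ n below                          ∎
  where
  open ≡-Reasoning
  below : Fin n → Fin n → ℕ
  below a b = 𝟙 ⌊ a Fin.<? b ⌋ * H a b
  by-order : ∀ a b → H a b ≡ below a b + below b a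
  by-order a b with a Fin.<? b | b Fin.<? a
  ... | yes a<b | yes b<a = ⊥-elim (Fin.<-asym a<b b<a)
  ... | yes _   | no  _   = sym (trans (+-identityʳ _) (+-identityʳ _))
  ... | no  _   | yes _   = trans (sym-H a b) (sym (+-identityʳ _))
  ... | no  a≮b | no  b≮a with Fin.toℕ-injective (≤-antisym (≮⇒≥ b≮a) (≮⇒≥ a≮b))
  ...   | refl = diag a

∑∑-pair : ∀ n {u v : Fin n} → u ≢ v → (H : Fin n → Fin n → ℕ) →
          ∑∑ n (λ a b → 𝟙 (eqF a u ∨ eqF a v) * H a b) ≡ ∑ (allFin n) (H u) + ∑ (allFin n) (H v)
∑∑-pair n {u} {v} u≢v H =
  trans (∑-cong (allFin n) (λ a → ∑-*ˡ (allFin n) (𝟙 (eqF a u ∨ eqF a v)) (H a)))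
        (∑-allFin-pair n u≢v (λ a → ∑ (allFin n) (H a)))

sumRange : ℕ → ℕ → (ℕ → ℕ) → ℕ
sumRange a zero    g = 0
sumRange a (suc l) g = g a + sumRange (suc a) l g

∑-allFin≡sumRange : ∀ l a (f : Fin l → ℕ) (g : ℕ → ℕ) → (∀ i → g (a + toℕ i) ≡ f i) →
                    ∑ (allFin l) f ≡ sumRange a l g
∑-allFin≡sumRange zero    a f g f≗g = refl
∑-allFin≡sumRange (suc l) a f g f≗g = trans (∑-allFin-suc l f) (cong₂ _+_ head tail)
  where
  head : f zero ≡ g a
  head = trans (sym (f≗g zero)) (cong g (+-identityʳ a))
  tail : ∑ (allFin l) (f ∘ suc) ≡ sumRange (suc a) l g
  tail = ∑-allFin≡sumRange l (suc a) (f ∘ suc) g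
           (λ i → trans (cong g (sym (+-suc a (toℕ i)))) (f≗g (suc i)))

sumRange-+ : ∀ a l₁ l₂ g → sumRange a (l₁ + l₂) g ≡ sumRange a l₁ g + sumRange (a + l₁) l₂ g
sumRange-+ a zero     l₂ g = cong (λ b → sumRange b l₂ g) (sym (+-identityʳ a))
sumRange-+ a (suc l₁) l₂ g = begin
  g a + sumRange (suc a) (l₁ + l₂) g
    ≡⟨ cong (g a +_) (sumRange-+ (suc a) l₁ l₂ g) ⟩
  g a + (sumRange (suc a) l₁ g + sumRange (suc a + l₁) l₂ g)
    ≡⟨ sym (+-assoc (g a) _ _) ⟩
  g a + sumRange (suc a) l₁ g + sumRange (suc a + l₁) l₂ g
    ≡⟨ cong (λ b → g a + sumRange (suc a) l₁ g + sumRange b l₂ g) (sym (+-suc a l₁)) ⟩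
  g a + sumRange (suc a) l₁ g + sumRange (a + suc l₁) l₂ g   ∎
  where open ≡-Reasoning

sumRange-positive : ∀ a l g i → i < l → 0 < g (i + a) → 0 < sumRange a l g
sumRange-positive a (suc l) g zero    _         pos = <-≤-trans pos (m≤m+n (g a) _)
sumRange-positive a (suc l) g (suc i) (s≤s i<l) pos =
  <-≤-trans (sumRange-positive (suc a) l g i i<l (subst (λ t → 0 < g t) (sym (+-suc i a)) pos))
            (m≤n+m _ (g a))

sumRange-windows : ∀ w k a g → (∀ b → a ≤ b → w + b ≤ a + w * k → 0 < sumRange b w g) →
                   k ≤ sumRange a (w * k) g
sumRange-windows w zero    a g hit = z≤n
sumRange-windows w (suc k) a g hit = begin
  1 + k                                            ≤⟨ +-mono-≤ first rest ⟩
  sumRange a w g + sumRange (a + w) (w * k) g      ≡⟨ sym (sumRange-+ a w (w * k) g) ⟩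
  sumRange a (w + w * k) g                         ≡⟨ cong (λ l → sumRange a l g) (sym (*-suc w k)) ⟩
  sumRange a (w * suc k) g                         ∎
  where
  open ≤-Reasoning
  end≡ : a + w * suc k ≡ a + w + w * k
  end≡ = trans (cong (a +_) (*-suc w k)) (sym (+-assoc a w (w * k)))
  first : 0 < sumRange a w g
  first = hit a ≤-refl (≤-trans (≤-reflexive (+-comm w a))
                                (≤-trans (m≤m+n (a + w) (w * k)) (≤-reflexive (sym end≡))))
  rest : k ≤ sumRange (a + w) (w * k) g
  rest = sumRange-windows w k (a + w) g
           (λ b a+w≤b end → hit b (m+n≤o⇒m≤o a a+w≤b) (≤-trans end (≤-reflexive (sym end≡))))

WindowsHit : (ℕ → ℕ) → ℕ → Set
WindowsHit g m = ∀ b → 2 + b ≤ m → 0 < sumRange b 3 g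

module _ (g : ℕ → ℕ) where

  hits⇒windows : ∀ k → WindowsHit g (3 * k) → ∀ a j → (∀ b → 3 + b ≤ a + 3 * j → 2 + b ≤ 3 * k) →
                 j ≤ sumRange a (3 * j) g
  hits⇒windows k hits a j inside = sumRange-windows 3 j a g (λ b _ end → hits b (inside b end))

  hits⇒k≤ : ∀ k → WindowsHit g (3 * k) → k ≤ sumRange 0 (suc (3 * k)) g
  hits⇒k≤ k hits = ≤-trans (hits⇒windows k hits 1 k (λ _ → ≤-pred)) (m≤n+m _ (g 0))

  hits+first⇒k< : ∀ k → WindowsHit g (3 * k) → 0 < g 0 → k < sumRange 0 (suc (3 * k)) g
  hits+first⇒k< k hits g0 = +-mono-≤ g0 (hits⇒windows k hits 1 k (λ _ → ≤-pred))

  hits+last⇒k< : ∀ k → WindowsHit g (3 * k) → 0 < g (3 * k) → k < sumRange 0 (suc (3 * k)) g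
  hits+last⇒k< k hits gm = begin
    1 + k                                        ≡⟨ +-comm 1 k ⟩
    k + 1                                        ≤⟨ +-mono-≤ (hits⇒windows k hits 0 k (λ _ → ≤-trans (n≤1+n _)))
                                                              (sumRange-positive (3 * k) 1 g 0 (s≤s z≤n) gm) ⟩
    sumRange 0 (3 * k) g + sumRange (3 * k) 1 g  ≡⟨ sym (sumRange-+ 0 (3 * k) 1 g) ⟩
    sumRange 0 (3 * k + 1) g                     ≡⟨ cong (λ l → sumRange 0 l g) (+-comm (3 * k) 1) ⟩
    sumRange 0 (suc (3 * k)) g                   ∎
    where open ≤-Reasoning

  -- With k = j + 1: a hit in {0, 1}, j windows in [2, 3k − 1) and a hit in {3k − 1, 3k}.
  hits+inner⇒k< : ∀ k → WindowsHit g (3 * k) → 0 < g 1 → ∀ s → suc s ≡ 3 * k → 0 < g s →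
                  k < sumRange 0 (suc (3 * k)) g
  hits+inner⇒k< zero    hits g1 s s+1≡0 gs = ⊥-elim (1+n≢0 s+1≡0)
  hits+inner⇒k< (suc j) hits g1 s s+1≡m gs = begin
    2 + j                                                      ≡⟨ cong suc (+-comm 1 j) ⟩
    1 + (j + 1)                                                ≤⟨ +-mono-≤ front (+-mono-≤ middle back) ⟩
    sumRange 0 2 g + (sumRange 2 (3 * j) g + sumRange (2 + 3 * j) 2 g)
                                                               ≡⟨ cong (sumRange 0 2 g +_) (sym (sumRange-+ 2 (3 * j) 2 g)) ⟩
    sumRange 0 2 g + sumRange 2 (3 * j + 2) g                  ≡⟨ sym (sumRange-+ 0 2 (3 * j + 2) g) ⟩
    sumRange 0 (2 + (3 * j + 2)) g                             ≡⟨ cong (λ l → sumRange 0 l g) (sym length≡) ⟩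
    sumRange 0 (suc (3 * suc j)) g                             ∎
    where
    open ≤-Reasoning
    length≡ : suc (3 * suc j) ≡ 2 + (3 * j + 2)
    length≡ = trans (cong suc (*-suc 3 j)) (cong (2 +_) (+-comm 2 (3 * j)))
    s≡ : s ≡ 2 + 3 * j
    s≡ = suc-injective (trans s+1≡m (*-suc 3 j))
    front : 0 < sumRange 0 2 g
    front = sumRange-positive 0 2 g 1 ≤-refl g1
    middle : j ≤ sumRange 2 (3 * j) g
    middle = hits⇒windows (suc j) hits 2 j (λ b end → ≤-trans (≤-pred end)
                                      (≤-trans (m≤n+m _ 2) (≤-reflexive (sym (*-suc 3 j)))))
    back : 0 < sumRange (2 + 3 * j) 2 g
    back = sumRange-positive (2 + 3 * j) 2 g 0 (s≤s z≤n) (subst (λ t → 0 < g t) s≡ gs)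

-- Edges of G: the handshake lemma and the size of N′[e]

module Edges {n : ℕ} (G : Graph n) where

  end₁ end₂ : Edge G → Fin n
  end₁ = proj₁
  end₂ = proj₁ ∘ proj₂

  edge-≡ : ∀ {e e' : Edge G} → end₁ e ≡ end₁ e' → end₂ e ≡ end₂ e' → e ≡ e'
  edge-≡ {u , v , u<v , uv} {_ , _ , u<v′ , uv′} refl refl =
    cong₂ (λ p q → u , v , p , q) (<-irrelevant u<v u<v′) (T-irrelevant uv uv′)

  edgesAt : Fin n → Fin n → List (Edge G)
  edgesAt u v with u Fin.<? v | T? (adj G u v)
  ... | yes u<v | yes uv = (u , v , u<v , uv) ∷ []
  ... | _       | _      = []

  edges : List (Edge G)
  edges = concatMap (λ u → concatMap (edgesAt u) (allFin n)) (allFin n)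

  sumE≡∑-edges : ∀ f → sumE G f ≡ ∑ edges f
  sumE≡∑-edges f = sym (begin
    ∑ edges f
      ≡⟨ ∑-concatMap _ (allFin n) f ⟩
    ∑ (allFin n) (λ u → ∑ (concatMap (edgesAt u) (allFin n)) f)
      ≡⟨ ∑-cong (allFin n) (λ u → ∑-concatMap _ (allFin n) f) ⟩
    ∑ (allFin n) (λ u → ∑ (allFin n) (λ v → ∑ (edgesAt u v) f))
      ≡⟨ ∑∑-cong n term ⟩
    sumE G f ∎)
    where
    open ≡-Reasoning
    term : ∀ u v → ∑ (edgesAt u v) f ≡ sumEdgeTerm G f u v
    term u v with u Fin.<? v | T? (adj G u v)
    ... | yes _ | yes _ = +-identityʳ _
    ... | yes _ | no  _ = refl
    ... | no  _ | _     = refl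

  ∈-edges : ∀ e → e ∈ edges
  ∈-edges e@(u , v , u<v , uv) =
    ∈-concatMap⁺ _ (lose (∈-allFin u) (∈-concatMap⁺ (edgesAt u) (lose (∈-allFin v) ∈-edgesAt)))
    where
    ∈-edgesAt : e ∈ edgesAt u v
    ∈-edgesAt with u Fin.<? v | T? (adj G u v)
    ... | yes _   | yes _   = here (edge-≡ refl refl)
    ... | yes _   | no  ¬uv = ⊥-elim (¬uv uv)
    ... | no  u≮v | _       = ⊥-elim (u≮v u<v)

  sumE-cong : ∀ {f g : Edge G → ℕ} → (∀ e → f e ≡ g e) → sumE G f ≡ sumE G g
  sumE-cong {f} {g} f≗g = trans (sumE≡∑-edges f) (trans (∑-cong edges f≗g) (sym (sumE≡∑-edges g)))

  sumE-ordered-pairs : (F : Fin n → Fin n → ℕ) → (∀ a b → F a b ≡ F b a) →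
    2 * sumE G (λ e → F (end₁ e) (end₂ e)) ≡ ∑∑ n (λ a b → 𝟙 (adj G a b) * F a b)
  sumE-ordered-pairs F F-sym = begin
    2 * sumE G (λ e → F (end₁ e) (end₂ e))          ≡⟨ cong (2 *_) (∑∑-cong n term) ⟩
    2 * ∑∑ n (λ a b → 𝟙 ⌊ a Fin.<? b ⌋ * H a b)     ≡⟨ sym (∑∑-symmetric n H H-diag H-sym) ⟩
    ∑∑ n H                                          ∎
    where
    open ≡-Reasoning
    H : Fin n → Fin n → ℕ
    H a b = 𝟙 (adj G a b) * F a b
    H-diag : ∀ a → H a a ≡ 0
    H-diag a = cong (λ x → 𝟙 x * F a a) (irrefl G a)
    H-sym : ∀ a b → H a b ≡ H b a
    H-sym a b = cong₂ (λ x y → 𝟙 x * y) (Graph.sym G a b) (F-sym a b)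
    term : ∀ a b → sumEdgeTerm G (λ e → F (end₁ e) (end₂ e)) a b ≡ 𝟙 ⌊ a Fin.<? b ⌋ * H a b
    term a b with a Fin.<? b | T? (adj G a b)
    ... | yes _ | yes ab rewrite T⇒≡true ab = sym (trans (+-identityʳ _) (+-identityʳ _))
    ... | yes _ | no ¬ab rewrite ¬T⇒≡false ¬ab = refl
    ... | no  _ | _      = refl

  touches : Edge G → Fin n → Bool
  touches e x = eqF x (end₁ e) ∨ eqF x (end₂ e)

  inClosedNbhd≡touches : ∀ e′ e →
                         inClosedNbhd {G = G} e′ e ≡ touches e (end₁ e′) ∨ touches e (end₂ e′)
  inClosedNbhd≡touches (a , b , _) (u , v , _) = absorb (eqF a u) (eqF a v) (eqF b u) (eqF b v)
    where
    absorb : ∀ p q r s → (p ∧ s) ∨ (p ∨ q ∨ r ∨ s) ≡ (p ∨ q) ∨ (r ∨ s)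
    absorb true  q r s = ∨-zeroʳ s
    absorb false q r s = refl

  inClosedNbhd-sym : ∀ e′ e → inClosedNbhd {G = G} e′ e ≡ inClosedNbhd {G = G} e e′
  inClosedNbhd-sym e′@(a , b , _) e@(u , v , _) = begin
    inClosedNbhd {G = G} e′ e                       ≡⟨ inClosedNbhd≡touches e′ e ⟩
    (eqF a u ∨ eqF a v) ∨ (eqF b u ∨ eqF b v)       ≡⟨ ∨-interchange (eqF a u) _ _ _ ⟩
    (eqF a u ∨ eqF b u) ∨ (eqF a v ∨ eqF b v)       ≡⟨ cong₂ _∨_ (cong₂ _∨_ (eqF-sym a u) (eqF-sym b u))
                                                                (cong₂ _∨_ (eqF-sym a v) (eqF-sym b v)) ⟩
    (eqF u a ∨ eqF u b) ∨ (eqF v a ∨ eqF v b)       ≡⟨ sym (inClosedNbhd≡touches e e′) ⟩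
    inClosedNbhd {G = G} e e′                       ∎
    where open ≡-Reasoning

  IsEndpoint : Fin n → Edge G → Set
  IsEndpoint x e = x ≡ end₁ e ⊎ x ≡ end₂ e

  touches-endpoint : ∀ {x} e → IsEndpoint x e → touches e x ≡ true
  touches-endpoint {x} e (inj₁ refl) = ∨-introˡ (eqF-refl x)
  touches-endpoint {x} e (inj₂ refl) = ∨-introʳ (eqF x (end₁ e)) (eqF-refl x)

  inClosedNbhd-common-endpoint : ∀ {x} e′ e → IsEndpoint x e′ → IsEndpoint x e →
                                 inClosedNbhd {G = G} e′ e ≡ true
  inClosedNbhd-common-endpoint e′ e (inj₁ refl) x∈e =
    trans (inClosedNbhd≡touches e′ e) (∨-introˡ (touches-endpoint e x∈e))
  inClosedNbhd-common-endpoint e′ e (inj₂ refl) x∈e =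
    trans (inClosedNbhd≡touches e′ e) (∨-introʳ (touches e (end₁ e′)) (touches-endpoint e x∈e))

  inClosedNbhd-refl : ∀ e → inClosedNbhd {G = G} e e ≡ true
  inClosedNbhd-refl e = inClosedNbhd-common-endpoint e e (inj₁ refl) (inj₁ refl)

module RegularCounts {n : ℕ} (G : Graph n) {r : ℕ} (regular : Regular G r) where
  open Edges G

  handshake : 2 * ∑ edges (λ _ → 1) ≡ n * r
  handshake = begin
    2 * ∑ edges (λ _ → 1)             ≡⟨ cong (2 *_) (sym (sumE≡∑-edges (λ _ → 1))) ⟩
    2 * sumE G (λ _ → 1)              ≡⟨ sumE-ordered-pairs (λ _ _ → 1) (λ _ _ → refl) ⟩
    ∑∑ n (λ a b → 𝟙 (adj G a b) * 1)  ≡⟨ ∑∑-cong n (λ a b → *-identityʳ _) ⟩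
    ∑ (allFin n) (degree G)           ≡⟨ ∑-cong (allFin n) regular ⟩
    ∑ (allFin n) (λ _ → r)            ≡⟨ ∑-allFin-const n r ⟩
    n * r                             ∎
    where open ≡-Reasoning

  module _ {u v : Fin n} (u≢v : u ≢ v) where

    private
      at : Fin n → Bool
      at x = eqF x u ∨ eqF x v

    degrees-at-pair : ∑∑ n (λ a b → 𝟙 (at a) * 𝟙 (adj G a b)) ≡ 2 * r
    degrees-at-pair = trans (∑∑-pair n u≢v (λ a b → 𝟙 (adj G a b)))
                            (cong₂ _+_ (regular u) (trans (regular v) (sym (+-identityʳ r))))

    degrees-at-pair′ : ∑∑ n (λ a b → 𝟙 (at b) * 𝟙 (adj G a b)) ≡ 2 * r
    degrees-at-pair′ = trans (∑∑-transpose n _)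
      (trans (∑∑-cong n (λ a b → cong (λ x → 𝟙 (at a) * 𝟙 x) (Graph.sym G b a))) degrees-at-pair)

    edges-within-pair : adj G u v ≡ true → ∑∑ n (λ a b → 𝟙 (at a) * (𝟙 (at b) * 𝟙 (adj G a b))) ≡ 2
    edges-within-pair uv = begin
      ∑∑ n (λ a b → 𝟙 (at a) * (𝟙 (at b) * 𝟙 (adj G a b)))
        ≡⟨ ∑∑-pair n u≢v _ ⟩
      ∑ (allFin n) (λ b → 𝟙 (at b) * 𝟙 (adj G u b)) + ∑ (allFin n) (λ b → 𝟙 (at b) * 𝟙 (adj G v b))
        ≡⟨ cong₂ _+_ (∑-allFin-pair n u≢v _) (∑-allFin-pair n u≢v _) ⟩
      (𝟙 (adj G u u) + 𝟙 (adj G u v)) + (𝟙 (adj G v u) + 𝟙 (adj G v v))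
        ≡⟨ cong₂ _+_ (cong₂ _+_ (cong 𝟙 (irrefl G u)) (cong 𝟙 uv))
                     (cong₂ _+_ (cong 𝟙 (trans (Graph.sym G v u) uv)) (cong 𝟙 (irrefl G v))) ⟩
      2 ∎
      where open ≡-Reasoning

  closedNbhd-size-twice : ∀ e → 2 * sumE G (λ e′ → 𝟙 (inClosedNbhd {G = G} e′ e)) + 2 ≡ 2 * (2 * r)
  closedNbhd-size-twice e@(u , v , u<v , uv) = begin
    2 * sumE G (λ e′ → 𝟙 (inClosedNbhd {G = G} e′ e)) + 2
      ≡⟨ cong₂ _+_ (cong (2 *_) (sumE-cong (λ e′ → cong 𝟙 (inClosedNbhd≡touches e′ e))))
                   (sym (edges-within-pair u≢v (T⇒≡true uv))) ⟩
    2 * sumE G (λ e′ → F (end₁ e′) (end₂ e′)) + ∑∑ n inner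
      ≡⟨ cong (_+ ∑∑ n inner) (sumE-ordered-pairs F (λ a b → cong 𝟙 (∨-comm (at a) (at b)))) ⟩
    ∑∑ n (λ a b → 𝟙 (adj G a b) * F a b) + ∑∑ n inner
      ≡⟨ sym (∑∑-+ n _ inner) ⟩
    ∑∑ n (λ a b → 𝟙 (adj G a b) * F a b + inner a b)
      ≡⟨ ∑∑-cong n (λ a b → 𝟙-inclusion-exclusion (adj G a b) (at a) (at b)) ⟩
    ∑∑ n (λ a b → 𝟙 (at a) * 𝟙 (adj G a b) + 𝟙 (at b) * 𝟙 (adj G a b))
      ≡⟨ ∑∑-+ n _ _ ⟩
    ∑∑ n (λ a b → 𝟙 (at a) * 𝟙 (adj G a b)) + ∑∑ n (λ a b → 𝟙 (at b) * 𝟙 (adj G a b))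
      ≡⟨ cong₂ _+_ (degrees-at-pair u≢v) (degrees-at-pair′ u≢v) ⟩
    2 * r + 2 * r
      ≡⟨ cong (2 * r +_) (sym (+-identityʳ (2 * r))) ⟩
    2 * (2 * r) ∎
    where
    open ≡-Reasoning
    u≢v : u ≢ v
    u≢v = Fin.<⇒≢ u<v
    at : Fin n → Bool
    at = touches e
    F inner : Fin n → Fin n → ℕ
    F a b = 𝟙 (at a ∨ at b)
    inner a b = 𝟙 (at a) * (𝟙 (at b) * 𝟙 (adj G a b))

  closedNbhd-size : ∀ e → ∑ edges (λ e′ → 𝟙 (inClosedNbhd {G = G} e′ e)) ≡ 2 * r ∸ 1
  closedNbhd-size e = begin
    ∑ edges (λ e′ → 𝟙 (inClosedNbhd {G = G} e′ e))  ≡⟨ sym (sumE≡∑-edges _) ⟩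
    N                                                ≡⟨ sym (m+n∸n≡m N 1) ⟩
    N + 1 ∸ 1                                        ≡⟨ cong (_∸ 1) (*-cancelˡ-≡ (N + 1) (2 * r) 2 twice) ⟩
    2 * r ∸ 1                                        ∎
    where
    open ≡-Reasoning
    N : ℕ
    N = sumE G (λ e′ → 𝟙 (inClosedNbhd {G = G} e′ e))
    twice : 2 * (N + 1) ≡ 2 * (2 * r)
    twice = trans (*-distribˡ-+ 2 N 1) (closedNbhd-size-twice e)

-- The subdivision S(G) and perfect edge domination

lowerM-nothing : ∀ m (i : Fin (suc m)) → lowerM m i ≡ nothing → toℕ i ≡ m
lowerM-nothing zero    zero    _ = refl
lowerM-nothing (suc m) (suc i) _ with lowerM m i in eq
... | nothing = cong suc (lowerM-nothing m i eq)

lowerM-just : ∀ m (i : Fin (suc m)) {j} → lowerM m i ≡ just j → toℕ i ≡ toℕ j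
lowerM-just (suc m) zero    refl = refl
lowerM-just (suc m) (suc i) _ with lowerM m i in eq
lowerM-just (suc m) (suc i) refl | just j = cong suc (lowerM-just m i eq)

clamp : ∀ m → ℕ → Fin (suc m)
clamp m t with t ≤? m
... | yes t≤m = fromℕ< (s≤s t≤m)
... | no  _   = fromℕ m

toℕ-clamp : ∀ m t → t ≤ m → toℕ (clamp m t) ≡ t
toℕ-clamp m t t≤m with t ≤? m
... | yes _   = Fin.toℕ-fromℕ< _
... | no  t≰m = ⊥-elim (t≰m t≤m)

clamp-toℕ : ∀ m (i : Fin (suc m)) → clamp m (toℕ i) ≡ i
clamp-toℕ m i with toℕ i ≤? m
... | yes _   = Fin.fromℕ<-toℕ i _
... | no  i≰m = ⊥-elim (i≰m (Fin.toℕ≤pred[n] i))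

eqV⇒≡ : ∀ {n m} {a b : SVertex n m} → eqV a b ≡ true → a ≡ b
eqV⇒≡ {a = inj₁ a} {inj₁ b} eq = cong inj₁ (eqF⇒≡ eq)
eqV⇒≡ {a = inj₂ (a , b , c)} {inj₂ (a′ , b′ , c′)} eq
  with ∧-≡true (eqF a a′) eq
... | a≡ , eq′ with ∧-≡true (eqF b b′) eq′
...   | b≡ , c≡ rewrite eqF⇒≡ a≡ | eqF⇒≡ b≡ | eqF⇒≡ c≡ = refl

data Side : Set where
  left right : Side

module Subdivision {n : ℕ} (G : Graph n) (m : ℕ) where
  open Edges G

  idx : SEdge G m → ℕ
  idx = toℕ ∘ proj₂

  SEdge-≡ : ∀ {g f : SEdge G m} → proj₁ g ≡ proj₁ f → idx g ≡ idx f → g ≡ f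
  SEdge-≡ e≡ i≡ = cong₂ _,_ e≡ (Fin.toℕ-injective i≡)

  data IsEnd (e : Edge G) (t : ℕ) (x : Fin n) : Set where
    first : t ≡ 0 → x ≡ end₁ e → IsEnd e t x
    last  : t ≡ m → x ≡ end₂ e → IsEnd e t x

  IsEnd⇒IsEndpoint : ∀ {e t x} → IsEnd e t x → IsEndpoint x e
  IsEnd⇒IsEndpoint (first _ x≡) = inj₁ x≡
  IsEnd⇒IsEndpoint (last  _ x≡) = inj₂ x≡

  data Meet (g f : SEdge G m) : Set where
    at-vertex : ∀ x → IsEnd (proj₁ g) (idx g) x → IsEnd (proj₁ f) (idx f) x → Meet g f
    precedes  : proj₁ g ≡ proj₁ f → suc (idx g) ≡ idx f → Meet g f
    follows   : proj₁ g ≡ proj₁ f → idx g ≡ suc (idx f) → Meet g f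

  end : Side → SEdge G m → SVertex n m
  end left  = leftEnd {G = G} {m}
  end right = rightEnd {G = G} {m}

  position : Side → SEdge G m → ℕ
  position left  g = idx g
  position right g = suc (idx g)

  end-original : ∀ s g {x} → end s g ≡ inj₁ x → IsEnd (proj₁ g) (idx g) x
  end-original left  (e , zero) refl = first refl refl
  end-original right (e , i) eq with lowerM m i in i≡m
  end-original right (e , i) refl | nothing = last (lowerM-nothing m i i≡m) refl

  end-internal : ∀ s g {a b j} → end s g ≡ inj₂ (a , b , j) →
                 end₁ (proj₁ g) ≡ a × end₂ (proj₁ g) ≡ b × position s g ≡ suc (toℕ j)
  end-internal left  (e , suc j) refl = refl , refl , refl
  end-internal right (e , i) eq with lowerM m i in i≡j
  end-internal right (e , i) refl | just j = refl , refl , cong suc (lowerM-just m i i≡j)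

  same-end : ∀ s s′ g f → end s g ≡ end s′ f →
             (∃[ x ] IsEnd (proj₁ g) (idx g) x × IsEnd (proj₁ f) (idx f) x)
             ⊎ (proj₁ g ≡ proj₁ f × position s g ≡ position s′ f)
  same-end s s′ g f eq with end s′ f in eq′
  ... | inj₁ x = inj₁ (x , end-original s g eq , end-original s′ f eq′)
  ... | inj₂ (a , b , j) with end-internal s g eq | end-internal s′ f eq′
  ...   | a₁ , b₁ , p₁ | a₂ , b₂ , p₂ =
    inj₂ (edge-≡ (trans a₁ (sym a₂)) (trans b₁ (sym b₂)) , trans p₁ (sym p₂))

  same-end⇒Meet : ∀ s s′ {g f} → g ≢ f → end s g ≡ end s′ f → Meet g f
  same-end⇒Meet s s′ {g} {f} g≢f eq with same-end s s′ g f eq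
  ... | inj₁ (x , g-x , f-x) = at-vertex x g-x f-x
  ... | inj₂ (e≡ , p≡)       = on-path s s′ p≡
    where
    on-path : ∀ s s′ → position s g ≡ position s′ f → Meet g f
    on-path left  left  p≡ = ⊥-elim (g≢f (SEdge-≡ e≡ p≡))
    on-path left  right p≡ = follows e≡ p≡
    on-path right left  p≡ = precedes e≡ p≡
    on-path right right p≡ = ⊥-elim (g≢f (SEdge-≡ e≡ (suc-injective p≡)))

  dominates⇒Meet : ∀ {g f} → g ≢ f → dominates {G = G} {m} g f ≡ true → Meet g f
  dominates⇒Meet {g@((u , v , _) , i)} {f@((u′ , v′ , _) , i′)} g≢f dom
    with ∨-≡true (sameSEdge {G = G} {m} g f) dom
  ... | inj₁ same with ∧-≡true (eqF u u′) same
  ...   | u≡ , same′ with ∧-≡true (eqF v v′) same′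
  ...     | v≡ , i≡ = ⊥-elim (g≢f (cong₂ _,_ (edge-≡ (eqF⇒≡ u≡) (eqF⇒≡ v≡)) (eqF⇒≡ i≡)))
  dominates⇒Meet {g} {f} g≢f dom | inj₂ share
    with ∨-≡true (eqV (end left g) (end left f)) share
  ... | inj₁ ll = same-end⇒Meet left left g≢f (eqV⇒≡ ll)
  ... | inj₂ share′ with ∨-≡true (eqV (end left g) (end right f)) share′
  ...   | inj₁ lr = same-end⇒Meet left right g≢f (eqV⇒≡ lr)
  ...   | inj₂ share″ with ∨-≡true (eqV (end right g) (end left f)) share″
  ...     | inj₁ rl = same-end⇒Meet right left g≢f (eqV⇒≡ rl)
  ...     | inj₂ rr = same-end⇒Meet right right g≢f (eqV⇒≡ rr)

  countSE-positive : ∀ p → 0 < countSE G m p → ∃[ g ] p g ≡ true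
  countSE-positive p pos with ∑-positive edges _ (subst (0 <_) (sumE≡∑-edges _) pos)
  ... | e , pos′ with ∑-positive (allFin (suc m)) _ pos′
  ...   | i , pos″ = (e , i) , 𝟙-positive pos″

module Domination {n : ℕ} (G : Graph n) (m : ℕ) (P : SEdge G m → Bool)
                  (perfect : PerfectEdgeDominating G m P) where
  open Edges G
  open Subdivision G m

  P-separates : ∀ {g f} → P g ≡ true → P f ≡ false → g ≢ f
  P-separates Pg Pf refl with () ← trans (sym Pg) Pf

  dominator : ∀ f → P f ≡ false → ∃[ g ] P g ≡ true × Meet g f
  dominator f Pf = g , Pg , dominates⇒Meet {g} {f} (P-separates Pg Pf) dom
    where
    found : ∃[ g ] (P g ∧ dominates {G = G} {m} g f) ≡ true
    found = countSE-positive (λ g → P g ∧ dominates {G = G} {m} g f) (≤-reflexive (sym (perfect f Pf)))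
    g : SEdge G m
    g = proj₁ found
    Pg : P g ≡ true
    Pg = proj₁ (∧-≡true (P g) (proj₂ found))
    dom : dominates {G = G} {m} g f ≡ true
    dom = proj₂ (∧-≡true (P g) (proj₂ found))

  -- bits e t says whether eₜ ∈ P; clamp makes it total, with a junk value for t > m.
  bits : Edge G → ℕ → Bool
  bits e t = P (e , clamp m t)

  bits-idx : ∀ g → P g ≡ true → bits (proj₁ g) (idx g) ≡ true
  bits-idx (e , i) Pg = trans (cong (λ j → P (e , j)) (clamp-toℕ m i)) Pg

  data Covered (e : Edge G) (t : ℕ) : Set where
    self      : bits e t ≡ true → Covered e t
    previous  : ∀ s → suc s ≡ t → bits e s ≡ true → Covered e t
    next      : suc t ≤ m → bits e (suc t) ≡ true → Covered e t
    at-vertex : ∀ e′ t′ x → bits e′ t′ ≡ true → IsEnd e′ t′ x → IsEnd e t x → Covered e t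

  dominated⇒Covered : ∀ e t → t ≤ m → (∃[ g ] P g ≡ true × Meet g (e , clamp m t)) → Covered e t
  dominated⇒Covered e t t≤m (g , Pg , at-vertex x g-x f-x) =
    at-vertex (proj₁ g) (idx g) x (bits-idx g Pg) g-x (subst (λ t′ → IsEnd e t′ x) (toℕ-clamp m t t≤m) f-x)
  dominated⇒Covered e t t≤m ((_ , i) , Pg , precedes refl i+1≡) =
    previous (toℕ i) (trans i+1≡ (toℕ-clamp m t t≤m)) (bits-idx (e , i) Pg)
  dominated⇒Covered e t t≤m ((_ , i) , Pg , follows refl i≡) =
    next (subst (_≤ m) i≡t+1 (Fin.toℕ≤pred[n] i))
         (subst (λ t′ → bits e t′ ≡ true) i≡t+1 (bits-idx (e , i) Pg))
    where
    i≡t+1 : toℕ i ≡ suc t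
    i≡t+1 = trans i≡ (cong suc (toℕ-clamp m t t≤m))

  covered : ∀ e t → t ≤ m → Covered e t
  covered e t t≤m with P (e , clamp m t) in Pf
  ... | true  = self Pf
  ... | false = dominated⇒Covered e t t≤m (dominator (e , clamp m t) Pf)

  window-hit : ∀ e b → 2 + b ≤ m → 0 < sumRange b 3 (𝟙 ∘ bits e)
  window-hit e b 2+b≤m with covered e (suc b) (<⇒≤ 2+b≤m)
  ... | self h              = sumRange-positive b 3 (𝟙 ∘ bits e) 1 (s≤s (s≤s z≤n)) (𝟙-true h)
  ... | previous _ refl h   = sumRange-positive b 3 (𝟙 ∘ bits e) 0 (s≤s z≤n) (𝟙-true h)
  ... | next _ h            = sumRange-positive b 3 (𝟙 ∘ bits e) 2 ≤-refl (𝟙-true h)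
  ... | at-vertex _ _ _ _ _ (last b+1≡m _) = ⊥-elim (<⇒≢ 2+b≤m b+1≡m)


module PathCounts {n : ℕ} (G : Graph n) (k : ℕ) (P : SEdge G (3 * k) → Bool)
                  (perfect : PerfectEdgeDominating G (3 * k) P) where
  open Edges G
  open Subdivision G (3 * k)
  open Domination G (3 * k) P perfect

  pathCount : Edge G → ℕ
  pathCount e = ∑ (allFin (suc (3 * k))) (λ i → 𝟙 (P (e , i)))

  pathCount≡sumRange : ∀ e → pathCount e ≡ sumRange 0 (suc (3 * k)) (𝟙 ∘ bits e)
  pathCount≡sumRange e = ∑-allFin≡sumRange (suc (3 * k)) 0 _ _
    (λ i → cong (λ j → 𝟙 (P (e , j))) (clamp-toℕ (3 * k) i))

  pathCount-≥ : ∀ e → k ≤ pathCount e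
  pathCount-≥ e = subst (k ≤_) (sym (pathCount≡sumRange e)) (hits⇒k≤ _ k (window-hit e))

  heavy-path : ∀ e → k < sumRange 0 (suc (3 * k)) (𝟙 ∘ bits e) → k < pathCount e
  heavy-path e = subst (k <_) (sym (pathCount≡sumRange e))

  end-heavy : ∀ {e t x} → IsEnd e t x → bits e t ≡ true → k < pathCount e
  end-heavy {e} (first refl _) h = heavy-path e (hits+first⇒k< _ k (window-hit e) (𝟙-true h))
  end-heavy {e} (last  refl _) h = heavy-path e (hits+last⇒k< _ k (window-hit e) (𝟙-true h))

  countSNbhd≡ : ∀ e → countSNbhd G (3 * k) P e ≡
                       ∑ edges (λ e′ → 𝟙 (inClosedNbhd {G = G} e′ e) * pathCount e′)
  countSNbhd≡ e = trans (sumE≡∑-edges _)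
    (∑-cong edges (λ e′ → ∑-𝟙-∧ (allFin (suc (3 * k))) (inClosedNbhd {G = G} e′ e) (λ i → P (e′ , i))))

  HeavyNeighbour : Edge G → Set
  HeavyNeighbour e = ∃[ e′ ] inClosedNbhd {G = G} e′ e ≡ true × k < pathCount e′

  heavy-at-vertex : ∀ {e e′ t t′ x} → bits e′ t′ ≡ true → IsEnd e′ t′ x → IsEnd e t x →
                    HeavyNeighbour e
  heavy-at-vertex {e} {e′} h e′-x e-x =
    e′ , inClosedNbhd-common-endpoint e′ e (IsEnd⇒IsEndpoint e′-x) (IsEnd⇒IsEndpoint e-x) , end-heavy e′-x h

  heavy-neighbour : ∀ e → HeavyNeighbour e
  heavy-neighbour e with covered e 0 z≤n
  ... | self h                  = e , inClosedNbhd-refl e , end-heavy (first refl refl) h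
  ... | at-vertex _ _ _ h e′-x e-x = heavy-at-vertex h e′-x e-x
  ... | next _ h₁ with covered e (3 * k) ≤-refl
  ...   | self h                  = e , inClosedNbhd-refl e , end-heavy (last refl refl) h
  ...   | next m+1≤m _            = ⊥-elim (1+n≰n m+1≤m)
  ...   | at-vertex _ _ _ h e′-x e-x = heavy-at-vertex h e′-x e-x
  ...   | previous s s+1≡m h      = e , inClosedNbhd-refl e ,
    heavy-path e (hits+inner⇒k< _ k (window-hit e) (𝟙-true h₁) s s+1≡m (𝟙-true h))

-- Double counting

module NeighbourhoodCounts {n : ℕ} (G : Graph n) {r : ℕ} (regular : Regular G r) (k : ℕ)
                           (P : SEdge G (3 * k) → Bool) (perfect : PerfectEdgeDominating G (3 * k) P) where
  open Edges G
  open RegularCounts G regular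
  open PathCounts G k P perfect

  countSNbhd-> : ∀ e → (2 * r ∸ 1) * k < countSNbhd G (3 * k) P e
  countSNbhd-> e with heavy-neighbour e
  ... | e* , e*∈N′[e] , k<p = begin-strict
    (2 * r ∸ 1) * k                            ≡⟨ cong (_* k) (sym (closedNbhd-size e)) ⟩
    ∑ edges (λ e′ → 𝟙 (N′ e′)) * k             ≡⟨ sym (∑-*ʳ edges k _) ⟩
    ∑ edges (λ e′ → 𝟙 (N′ e′) * k)             <⟨ ∑-mono-< (λ e′ → *-monoʳ-≤ (𝟙 (N′ e′)) (pathCount-≥ e′))
                                                           (∈-edges e*) heavy ⟩
    ∑ edges (λ e′ → 𝟙 (N′ e′) * pathCount e′)  ≡⟨ sym (countSNbhd≡ e) ⟩
    countSNbhd G (3 * k) P e                    ∎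
    where
    open ≤-Reasoning
    N′ : Edge G → Bool
    N′ e′ = inClosedNbhd {G = G} e′ e
    heavy : 𝟙 (N′ e*) * k < 𝟙 (N′ e*) * pathCount e*
    heavy rewrite e*∈N′[e] = +-monoˡ-< 0 k<p

  ∑-countSNbhd : ∑ edges (countSNbhd G (3 * k) P) ≡ (2 * r ∸ 1) * ∑ edges pathCount
  ∑-countSNbhd = begin
    ∑ edges (countSNbhd G (3 * k) P)
      ≡⟨ ∑-cong edges countSNbhd≡ ⟩
    ∑ edges (λ e → ∑ edges (λ e′ → 𝟙 (N′ e′ e) * pathCount e′))
      ≡⟨ ∑-comm edges edges _ ⟩
    ∑ edges (λ e′ → ∑ edges (λ e → 𝟙 (N′ e′ e) * pathCount e′))
      ≡⟨ ∑-cong edges (λ e′ → ∑-*ʳ edges (pathCount e′) _) ⟩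
    ∑ edges (λ e′ → ∑ edges (λ e → 𝟙 (N′ e′ e)) * pathCount e′)
      ≡⟨ ∑-cong edges (λ e′ → cong (_* pathCount e′) (size e′)) ⟩
    ∑ edges (λ e′ → (2 * r ∸ 1) * pathCount e′)
      ≡⟨ ∑-*ˡ edges (2 * r ∸ 1) pathCount ⟩
    (2 * r ∸ 1) * ∑ edges pathCount ∎
    where
    open ≡-Reasoning
    N′ : Edge G → Edge G → Bool
    N′ e′ e = inClosedNbhd {G = G} e′ e
    size : ∀ e′ → ∑ edges (λ e → 𝟙 (N′ e′ e)) ≡ 2 * r ∸ 1
    size e′ = trans (∑-cong edges (λ e → cong 𝟙 (inClosedNbhd-sym e′ e))) (closedNbhd-size e′)

lemma8 : (n r : ℕ) (G : Graph n) → Regular G r → (k : ℕ)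
         → (P : SEdge G (3 * k) → Bool) → PerfectEdgeDominating G (3 * k) P
         → ((e : Edge G) → 2 * r * k ∸ k + 1 ≤ countSNbhd G (3 * k) P e)
           × (n * r * (2 * r * k ∸ k + 1) ≤ 2 * (2 * r ∸ 1) * countSE G (3 * k) P)
lemma8 n r G regular k P perfect = local , global
  where
  open Edges G
  open RegularCounts G regular
  open PathCounts G k P perfect
  open NeighbourhoodCounts G regular k P perfect

  c : ℕ
  c = 2 * r * k ∸ k + 1

  local : ∀ e → c ≤ countSNbhd G (3 * k) P e
  local e = subst (_≤ countSNbhd G (3 * k) P e) c≡ (countSNbhd-> e)
    where
    c≡ : suc ((2 * r ∸ 1) * k) ≡ c
    c≡ = trans (+-comm 1 _)
               (cong (_+ 1) (trans (*-distribʳ-∸ k (2 * r) 1) (cong (2 * r * k ∸_) (*-identityˡ k))))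

  local′ : ∀ e → 1 * c ≤ countSNbhd G (3 * k) P e
  local′ e = subst (_≤ countSNbhd G (3 * k) P e) (sym (*-identityˡ c)) (local e)

  global : n * r * c ≤ 2 * (2 * r ∸ 1) * countSE G (3 * k) P
  global = begin
    n * r * c                               ≡⟨ cong (_* c) (sym handshake) ⟩
    2 * ∑ edges (λ _ → 1) * c               ≡⟨ *-assoc 2 (∑ edges (λ _ → 1)) c ⟩
    2 * (∑ edges (λ _ → 1) * c)             ≡⟨ cong (2 *_) (sym (∑-*ʳ edges c (λ _ → 1))) ⟩
    2 * ∑ edges (λ _ → 1 * c)               ≤⟨ *-monoʳ-≤ 2 (∑-mono-≤ edges local′) ⟩
    2 * ∑ edges (countSNbhd G (3 * k) P)    ≡⟨ cong (2 *_) ∑-countSNbhd ⟩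
    2 * ((2 * r ∸ 1) * ∑ edges pathCount)   ≡⟨ sym (*-assoc 2 (2 * r ∸ 1) _) ⟩
    2 * (2 * r ∸ 1) * ∑ edges pathCount     ≡⟨ cong (2 * (2 * r ∸ 1) *_) (sym (sumE≡∑-edges pathCount)) ⟩
    2 * (2 * r ∸ 1) * countSE G (3 * k) P   ∎
    where open ≤-Reasoning
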